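{- Let $X$ be a finite pure $d$-dimensional simplicial complex, $0\le i<d$, and $0<\eta<1$. Then for every $i$-cochain $W\subseteq X(i)$ and every $-1\le j\le i$, $$\|W\|\ge\eta^{2^{i-j}-1}\,\|S^j(W)\|.$$
   Context: A simplicial complex $X$ on a finite vertex set is a family of subsets (faces) closed under taking subsets; it contains $\emptyset$. A face $\sigma$ has dimension $|\sigma|-1$; $X(i)$ is the set of $i$-faces, $X(-1)=\{\emptyset\}$. $X$ is $d$-dimensional if its maximal face dimension is $d$, pure if every face lies in a $d$-face. $\deg(\sigma)$ is the number of $d$-faces containing $\sigma$. For $U\subseteq X(k)$, $\|U\|=\sum_{\sigma\in U}\deg(\sigma)/\sum_{\tau\in X(k)}\deg(\tau)$. The link of $\sigma$ is $X_\sigma=\{\tau\setminus\sigma:\tau\in X,\tau\supseteq\sigma\}$, a pure complex of dimension $d-|\sigma|$, and $\|\cdot\|_\sigma$ is the norm computed in $X_\sigma$ (degrees = numbers of top faces of $X_\sigma$). For $U\subseteq X(k)$ and a face $\sigma$ of dimension $<k$, $U_\sigma=\{\tau\in X_\sigma:\tau\sqcup\sigma\in U\}$. Fat faces (fatness constant $\eta$): $S^i(W)=W$, and for $-1\le j<i$, $S^j(W)=\{\sigma\in X(j):\|S^{j+1}(W)_\sigma\|_\sigma\ge\eta^{2^{i-j-1}}\}$.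
   Formalization: The fatness constant η ranges over the rationals with $0<\eta<1$. -}

module Defs where

open import Data.Nat as ℕ using (ℕ; zero; suc; _+_; _∸_)
open import Data.Bool using (Bool; true; false; _∧_; _∨_; not; if_then_else_; T)
open import Data.Bool.Properties using (T?)
open import Data.Vec using (Vec; []; _∷_; replicate)
open import Data.List using (List; []; _∷_; map; _++_; filter; length)
open import Data.Nat.ListAction using (sum)
open import Data.Fin.Subset using (Subset; _∪_; ∣_∣; _⊆_)
open import Data.Integer using (+_)
open import Data.Rational using (ℚ; 0ℚ; 1ℚ; _/_; _*_; _≤ᵇ_)
open import Data.Product using (Σ; _×_; _,_)
open import Relation.Binary.PropositionalEquality using (_≡_)

Family : ℕ → Set
Family n = Subset n → Bool

allSubsets : (n : ℕ) → List (Subset n)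
allSubsets zero    = [] ∷ []
allSubsets (suc n) = map (true ∷_) (allSubsets n) ++ map (false ∷_) (allSubsets n)

_⊆ᵇ_ : ∀ {n} → Subset n → Subset n → Bool
[]      ⊆ᵇ []      = true
(x ∷ s) ⊆ᵇ (y ∷ t) = (not x ∨ y) ∧ (s ⊆ᵇ t)

disjᵇ : ∀ {n} → Subset n → Subset n → Bool
disjᵇ []      []      = true
disjᵇ (x ∷ s) (y ∷ t) = not (x ∧ y) ∧ disjᵇ s t

_==_ : ℕ → ℕ → Bool
zero  == zero  = true
zero  == suc _ = false
suc _ == zero  = false
suc m == suc k = m == k

-- natural-number ratio a / b as a rational (0 when b = 0; never used in that case
-- for pure complexes, since the relevant denominators are positive)
ratio : ℕ → ℕ → ℚ
ratio a zero    = 0ℚ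
ratio a (suc b) = (+ a) / suc b

_^ℚ_ : ℚ → ℕ → ℚ
q ^ℚ zero  = 1ℚ
q ^ℚ suc k = q * (q ^ℚ k)

-- Convention: faces are indexed by their SIZE s = dimension + 1, so
-- X(k) = faces of size k+1, and X(-1) = {∅} is size 0.

facesOfSize : ∀ {n} → Family n → ℕ → List (Subset n)
facesOfSize {n} X s = filter (λ σ → T? (X σ ∧ (∣ σ ∣ == s))) (allSubsets n)

deg : ∀ {n} → Family n → ℕ → Subset n → ℕ
deg X D σ = length (filter (λ ρ → T? (σ ⊆ᵇ ρ)) (facesOfSize X D))

norm : ∀ {n} → Family n → ℕ → ℕ → Family n → ℚ
norm X D s U =
  ratio (sum (map (λ σ → if U σ then deg X D σ else 0) (facesOfSize X s)))
        (sum (map (deg X D) (facesOfSize X s)))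

-- the link X_σ, as a family on the same vertex set: τ ∈ X_σ iff τ ∩ σ = ∅ and τ ∪ σ ∈ X
-- (this is exactly {τ \ σ : τ ∈ X, τ ⊇ σ})
link : ∀ {n} → Family n → Subset n → Family n
link X σ τ = disjᵇ τ σ ∧ X (τ ∪ σ)

restr : ∀ {n} → Family n → Family n → Subset n → Family n
restr X U σ τ = link X σ τ ∧ U (τ ∪ σ)

-- ‖U_σ‖_σ : norm in the link X_σ (pure of dimension d - |σ|, i.e. top size D - |σ|),
-- where U ⊆ X(s-1), so U_σ lives in level size s - |σ| of the link.
linkNorm : ∀ {n} → Family n → ℕ → ℕ → Family n → Subset n → ℚ
linkNorm X D s U σ = norm (link X σ) (D ∸ ∣ σ ∣) (s ∸ ∣ σ ∣) (restr X U σ)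

record IsSimplicialComplex {n : ℕ} (X : Family n) : Set where
  field
    hasEmpty : X (replicate n false) ≡ true
    downClosed : ∀ σ τ → τ ⊆ σ → X σ ≡ true → X τ ≡ true

record IsPure {n : ℕ} (X : Family n) (d : ℕ) : Set where
  field
    dimBound : ∀ σ → X σ ≡ true → ∣ σ ∣ ℕ.≤ suc d
    topExists : Σ (Subset n) (λ ρ → X ρ ≡ true × ∣ ρ ∣ ≡ suc d)
    pure : ∀ σ → X σ ≡ true → Σ (Subset n) (λ ρ → X ρ ≡ true × ∣ ρ ∣ ≡ suc d × σ ⊆ ρ)

-- For W ⊆ X(i) (i.e. faces of size i+1), with fatness constant η,
-- fat X d η i W g = S^{i-g}(W), for g = 0, 1, ..., i+1 (so j = i - g ranges down to -1).
--   S^i(W) = W,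
--   S^j(W) = {σ ∈ X(j) : ‖S^{j+1}(W)_σ‖_σ ≥ η^(2^(i-j-1))}.
fat : ∀ {n} → Family n → ℕ → ℚ → ℕ → Family n → ℕ → Family n
fat X d η i W zero    = W
fat X d η i W (suc g) σ =
  X σ ∧ (∣ σ ∣ == (suc i ∸ suc g)) ∧
  ((η ^ℚ (2 ℕ.^ g)) ≤ᵇ linkNorm X (suc d) (suc i ∸ g) (fat X d η i W g) σ)

-- For a face σ of size s, the density of U ⊆ X(s) in the link of σ is
-- Σ {deg ρ : ρ ∈ U, ρ ⊃ σ} / ((D − s) · deg σ), where D = d + 1 is the size of the top faces.
-- If every σ in V ⊆ X(s − 1) has link density at least c, summing these bounds over V counts
-- every ρ ∈ U once for each of its s + 1 facets, so c · (D − s) · Σ_V deg ≤ (s + 1) · Σ_U deg.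
-- The same double counting gives (s + 1) · Σ_{X(s)} deg = (D − s) · Σ_{X(s−1)} deg, and
-- together c ‖V‖ ≤ ‖U‖. Applied to V = S^j(W), U = S^{j+1}(W) and c = η^(2^(i−j−1)) and
-- iterated from j = i downwards, the exponents add up to 2^(i−j) − 1.

module Submission where

open import Algebra.Properties.CommutativeSemigroup using (interchange)
open import Data.Bool.Base using (Bool; true; false; _∧_; _∨_; not; if_then_else_; T)
open import Data.Bool.Properties using (T?; ∧-zeroʳ; if-eta)
open import Data.Fin.Subset using (Subset; _∪_; ∣_∣; _⊆_; ⊥)
open import Data.Fin.Subset.Properties using (drop-∷-⊆; ⊆-trans; ⊥⊆; ∣⊥∣≡0; q⊆p∪q; p⊆q⇒∣p∣≤∣q∣)
open import Data.Integer.Base as ℤ using (-[1+_]; +≤+)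
import Data.Integer.Properties as ℤₚ
open import Data.List.Base using (List; []; _∷_; map; _++_; filter; length)
open import Data.List.Properties using (map-++; map-∘)
open import Data.Nat.Base using (ℕ; zero; suc; _+_; _*_; _∸_; _^_; _≤_; _<_; z≤n; s≤s)
open import Data.Nat.Coprimality using (Coprime)
open import Data.Nat.Combinatorics using (_C_; nC1≡n; nCk≡nC[n∸k]; nCk+nC[k+1]≡[n+1]C[k+1])
open import Data.Nat.ListAction using (sum)
open import Data.Nat.ListAction.Properties using (sum-++)
open import Data.Nat.Properties
open import Data.Nat.Solver using (module +-*-Solver)
open import Data.Product.Base using (_×_; _,_; proj₁; proj₂)
open import Data.Rational.Base as ℚ using (ℚ; mkℚ; 0ℚ; toℚᵘ)
import Data.Rational.Properties as ℚₚ
import Data.Rational.Unnormalised.Base as ℚᵘ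
import Data.Rational.Unnormalised.Properties as ℚᵘₚ
open import Data.Unit.Base using (tt)
open import Data.Vec.Base using ([]; _∷_; here; there)
open import Function.Base using (_∘_)
open import Relation.Binary.PropositionalEquality

open import Defs

∑ : ∀ {n} → (Subset n → ℕ) → ℕ
∑ {zero}  f = f []
∑ {suc n} f = ∑ (λ σ → f (true ∷ σ)) + ∑ (λ σ → f (false ∷ σ))

∑-cong : ∀ {n} {f g : Subset n → ℕ} → (∀ σ → f σ ≡ g σ) → ∑ f ≡ ∑ g
∑-cong {zero}  f≡g = f≡g []
∑-cong {suc n} f≡g = cong₂ _+_ (∑-cong (f≡g ∘ (true ∷_))) (∑-cong (f≡g ∘ (false ∷_)))

∑-mono : ∀ {n} {f g : Subset n → ℕ} → (∀ σ → f σ ≤ g σ) → ∑ f ≤ ∑ g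
∑-mono {zero}  f≤g = f≤g []
∑-mono {suc n} f≤g = +-mono-≤ (∑-mono (f≤g ∘ (true ∷_))) (∑-mono (f≤g ∘ (false ∷_)))

∑-zero : ∀ {n} {f : Subset n → ℕ} → (∀ σ → f σ ≡ 0) → ∑ f ≡ 0
∑-zero {zero}  f≡0 = f≡0 []
∑-zero {suc n} f≡0 = cong₂ _+_ (∑-zero (f≡0 ∘ (true ∷_))) (∑-zero (f≡0 ∘ (false ∷_)))

∑-+ : ∀ {n} (f g : Subset n → ℕ) → ∑ (λ σ → f σ + g σ) ≡ ∑ f + ∑ g
∑-+ {zero}  f g = refl
∑-+ {suc n} f g = trans (cong₂ _+_ (∑-+ {n} (f ∘ (true ∷_)) (g ∘ (true ∷_)))
                                     (∑-+ {n} (f ∘ (false ∷_)) (g ∘ (false ∷_))))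
                         (interchange +-commutativeSemigroup (∑ (f ∘ (true ∷_))) (∑ (g ∘ (true ∷_)))
                                                             (∑ (f ∘ (false ∷_))) (∑ (g ∘ (false ∷_))))

∑-*ˡ : ∀ {n} k (f : Subset n → ℕ) → ∑ (λ σ → k * f σ) ≡ k * ∑ f
∑-*ˡ {zero}  k f = refl
∑-*ˡ {suc n} k f = trans (cong₂ _+_ (∑-*ˡ {n} k _) (∑-*ˡ {n} k _)) (sym (*-distribˡ-+ k _ _))

∑-*ʳ : ∀ {n} k (f : Subset n → ℕ) → ∑ (λ σ → f σ * k) ≡ ∑ f * k
∑-*ʳ k f = trans (∑-cong (λ σ → *-comm (f σ) k)) (trans (∑-*ˡ k f) (*-comm k (∑ f)))

∑-swap : ∀ {m n} (f : Subset m → Subset n → ℕ) →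
         ∑ (λ σ → ∑ (f σ)) ≡ ∑ (λ τ → ∑ (λ σ → f σ τ))
∑-swap {zero}  f = refl
∑-swap {suc m} {n} f = trans (cong₂ _+_ (∑-swap {m} (f ∘ (true ∷_))) (∑-swap {m} (f ∘ (false ∷_))))
                             (sym (∑-+ {n} (λ τ → ∑ (λ σ → f (true ∷ σ) τ)) (λ τ → ∑ (λ σ → f (false ∷ σ) τ))))

∑-if : ∀ {n} b (f : Subset n → ℕ) → (if b then ∑ f else 0) ≡ ∑ (λ σ → if b then f σ else 0)
∑-if true  f = refl
∑-if {n} false f = sym (∑-zero {n} (λ _ → refl))

∑-cong-if : ∀ {n} (b : Subset n → Bool) {f g : Subset n → ℕ} → (∀ σ → b σ ≡ true → f σ ≡ g σ) →
            ∑ (λ σ → if b σ then f σ else 0) ≡ ∑ (λ σ → if b σ then g σ else 0)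
∑-cong-if b f≡g = ∑-cong pointwise
  where
  pointwise : ∀ σ → (if b σ then _ else 0) ≡ (if b σ then _ else 0)
  pointwise σ with b σ in bσ
  ... | true  = f≡g σ bσ
  ... | false = refl

sum-map-allSubsets : ∀ {n} (f : Subset n → ℕ) → sum (map f (allSubsets n)) ≡ ∑ f
sum-map-allSubsets {zero}  f = +-identityʳ (f [])
sum-map-allSubsets {suc n} f = begin
  sum (map f (map (true ∷_) A ++ map (false ∷_) A))
    ≡⟨ cong sum (map-++ f (map (true ∷_) A) _) ⟩
  sum (map f (map (true ∷_) A) ++ map f (map (false ∷_) A))
    ≡⟨ sum-++ (map f (map (true ∷_) A)) _ ⟩
  sum (map f (map (true ∷_) A)) + sum (map f (map (false ∷_) A))
    ≡⟨ cong₂ _+_ (trans (cong sum (sym (map-∘ A))) (sum-map-allSubsets {n} _))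
                 (trans (cong sum (sym (map-∘ A))) (sum-map-allSubsets {n} _)) ⟩
  ∑ f ∎
  where
  open ≡-Reasoning
  A = allSubsets n

sum-map-filter : ∀ {A : Set} (p : A → Bool) (f : A → ℕ) (xs : List A) →
                 sum (map f (filter (T? ∘ p) xs)) ≡ sum (map (λ x → if p x then f x else 0) xs)
sum-map-filter p f []       = refl
sum-map-filter p f (x ∷ xs) with p x
... | true  = cong (f x +_) (sum-map-filter p f xs)
... | false = sum-map-filter p f xs

length≡sum-map-1 : ∀ {A : Set} (xs : List A) → length xs ≡ sum (map (λ _ → 1) xs)
length≡sum-map-1 []       = refl
length≡sum-map-1 (x ∷ xs) = cong suc (length≡sum-map-1 xs)

∧≡true⁻ : ∀ {a b : Bool} → a ∧ b ≡ true → a ≡ true × b ≡ true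
∧≡true⁻ {true} b≡true = refl , b≡true

⊆ᵇ⇒⊆ : ∀ {n} (a b : Subset n) → (a ⊆ᵇ b) ≡ true → a ⊆ b
⊆ᵇ⇒⊆ (true  ∷ a) (true  ∷ b) a⊆b here      = here
⊆ᵇ⇒⊆ (x     ∷ a) (true  ∷ b) a⊆b (there i) = there (⊆ᵇ⇒⊆ a b (proj₂ (∧≡true⁻ {not x ∨ true} a⊆b)) i)
⊆ᵇ⇒⊆ (false ∷ a) (false ∷ b) a⊆b (there i) = there (⊆ᵇ⇒⊆ a b a⊆b i)

⊆⇒⊆ᵇ : ∀ {n} (a b : Subset n) → a ⊆ b → (a ⊆ᵇ b) ≡ true
⊆⇒⊆ᵇ []          []          _   = refl
⊆⇒⊆ᵇ (true  ∷ a) (true  ∷ b) a⊆b = ⊆⇒⊆ᵇ a b (drop-∷-⊆ a⊆b)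
⊆⇒⊆ᵇ (true  ∷ a) (false ∷ b) a⊆b with () ← a⊆b here
⊆⇒⊆ᵇ (false ∷ a) (_     ∷ b) a⊆b = ⊆⇒⊆ᵇ a b (drop-∷-⊆ a⊆b)

⊆ᵇ-trans : ∀ {n} (a b c : Subset n) → (a ⊆ᵇ b) ≡ true → (b ⊆ᵇ c) ≡ true → (a ⊆ᵇ c) ≡ true
⊆ᵇ-trans a b c a⊆b b⊆c = ⊆⇒⊆ᵇ a c (⊆-trans (⊆ᵇ⇒⊆ a b a⊆b) (⊆ᵇ⇒⊆ b c b⊆c))

⊆ᵇ⇒∣∣≤∣∣ : ∀ {n} (a b : Subset n) → (a ⊆ᵇ b) ≡ true → ∣ a ∣ ≤ ∣ b ∣
⊆ᵇ⇒∣∣≤∣∣ a b a⊆b = p⊆q⇒∣p∣≤∣q∣ (⊆ᵇ⇒⊆ a b a⊆b)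

∣p∪q∣≡∣p∣+∣q∣ : ∀ {n} (p q : Subset n) → disjᵇ p q ≡ true → ∣ p ∪ q ∣ ≡ ∣ p ∣ + ∣ q ∣
∣p∪q∣≡∣p∣+∣q∣ []          []          _ = refl
∣p∪q∣≡∣p∣+∣q∣ (true  ∷ p) (false ∷ q) d = cong suc (∣p∪q∣≡∣p∣+∣q∣ p q d)
∣p∪q∣≡∣p∣+∣q∣ (false ∷ p) (true  ∷ q) d = trans (cong suc (∣p∪q∣≡∣p∣+∣q∣ p q d)) (sym (+-suc ∣ p ∣ ∣ q ∣))
∣p∪q∣≡∣p∣+∣q∣ (false ∷ p) (false ∷ q) d = ∣p∪q∣≡∣p∣+∣q∣ p q d

p∪r⊆ᵇq∪r≡p⊆ᵇq : ∀ {n} (p q r : Subset n) → disjᵇ p r ≡ true → disjᵇ q r ≡ true →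
                ((p ∪ r) ⊆ᵇ (q ∪ r)) ≡ (p ⊆ᵇ q)
p∪r⊆ᵇq∪r≡p⊆ᵇq []          []          []          _ _ = refl
p∪r⊆ᵇq∪r≡p⊆ᵇq (false ∷ p) (false ∷ q) (true ∷ r)  d e = p∪r⊆ᵇq∪r≡p⊆ᵇq p q r d e
p∪r⊆ᵇq∪r≡p⊆ᵇq (true  ∷ p) (true  ∷ q) (false ∷ r) d e = p∪r⊆ᵇq∪r≡p⊆ᵇq p q r d e
p∪r⊆ᵇq∪r≡p⊆ᵇq (true  ∷ p) (false ∷ q) (false ∷ r) d e = refl
p∪r⊆ᵇq∪r≡p⊆ᵇq (false ∷ p) (true  ∷ q) (false ∷ r) d e = p∪r⊆ᵇq∪r≡p⊆ᵇq p q r d e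
p∪r⊆ᵇq∪r≡p⊆ᵇq (false ∷ p) (false ∷ q) (false ∷ r) d e = p∪r⊆ᵇq∪r≡p⊆ᵇq p q r d e

-- The disjoint translate τ ↦ τ ∪ σ is a bijection onto the supersets of σ.
∑-disjoint-∪ : ∀ {n} (σ : Subset n) (g : Subset n → ℕ) →
               ∑ (λ τ → if disjᵇ τ σ then g (τ ∪ σ) else 0) ≡ ∑ (λ ρ → if σ ⊆ᵇ ρ then g ρ else 0)
∑-disjoint-∪ []          g = refl
∑-disjoint-∪ {suc n} (true ∷ σ) g =
  trans (cong₂ _+_ (∑-zero {n} (λ _ → refl)) (∑-disjoint-∪ σ (g ∘ (true ∷_))))
        (sym (trans (cong (∑ (λ ρ → if σ ⊆ᵇ ρ then g (true ∷ ρ) else 0) +_) (∑-zero {n} (λ _ → refl)))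
                     (+-identityʳ _)))
∑-disjoint-∪ (false ∷ σ) g =
  cong₂ _+_ (∑-disjoint-∪ σ (g ∘ (true ∷_))) (∑-disjoint-∪ σ (g ∘ (false ∷_)))

==⇒≡ : ∀ {a b} → (a == b) ≡ true → a ≡ b
==⇒≡ {zero}  {zero}  _ = refl
==⇒≡ {suc a} {suc b} e = cong suc (==⇒≡ e)

<⇒==≡false : ∀ {a b} → a < b → (b == a) ≡ false
<⇒==≡false {zero}  {suc b} _         = refl
<⇒==≡false {suc a} {suc b} (s≤s a<b) = <⇒==≡false a<b

==-+ˡ : ∀ c {a b} → ((c + a) == (c + b)) ≡ (a == b)
==-+ˡ zero    = refl
==-+ˡ (suc c) = ==-+ˡ c

==-+ʳ : ∀ c {a b} → ((a + c) == (b + c)) ≡ (a == b)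
==-+ʳ c {a} {b} = trans (cong₂ _==_ (+-comm a c) (+-comm b c)) (==-+ˡ c)

==-∸ : ∀ a {c D} → c ≤ D → (a == (D ∸ c)) ≡ ((a + c) == D)
==-∸ a {c} {D} c≤D = trans (sym (==-+ʳ c {a} {D ∸ c})) (cong ((a + c) ==_) (m∸n+n≡m c≤D))

-- Induction on the vertices: at a vertex of ρ₂ ∖ σ this is Pascal's rule.
count-interval≡C : ∀ {n} (σ ρ₂ : Subset n) k → (σ ⊆ᵇ ρ₂) ≡ true →
  ∑ (λ ρ → if σ ⊆ᵇ ρ ∧ (ρ ⊆ᵇ ρ₂ ∧ (∣ ρ ∣ == (∣ σ ∣ + k))) then 1 else 0) ≡ (∣ ρ₂ ∣ ∸ ∣ σ ∣) C k
count-interval≡C []          []           zero    _ = refl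
count-interval≡C []          []           (suc k) _ = refl
count-interval≡C {suc n} (true ∷ σ) (true ∷ ρ₂) k σ⊆ρ₂ =
  trans (cong₂ _+_ (count-interval≡C σ ρ₂ k σ⊆ρ₂) (∑-zero {n} (λ _ → refl))) (+-identityʳ _)
count-interval≡C {suc n} (false ∷ σ) (false ∷ ρ₂) k σ⊆ρ₂ =
  cong₂ _+_ (∑-zero {n} (λ ρ → cong (λ b → if b then 1 else 0) (∧-zeroʳ (σ ⊆ᵇ ρ))))
            (count-interval≡C σ ρ₂ k σ⊆ρ₂)
count-interval≡C {suc n} (false ∷ σ) (true ∷ ρ₂) zero σ⊆ρ₂ =
  cong₂ _+_ (∑-zero {n} tooLarge) (count-interval≡C σ ρ₂ zero σ⊆ρ₂)
  where
  tooLarge : ∀ ρ → (if σ ⊆ᵇ ρ ∧ (ρ ⊆ᵇ ρ₂ ∧ (suc ∣ ρ ∣ == (∣ σ ∣ + 0))) then 1 else 0) ≡ 0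
  tooLarge ρ with σ ⊆ᵇ ρ in σ⊆ρ
  ... | false = refl
  ... | true = trans (cong (λ b → if ρ ⊆ᵇ ρ₂ ∧ b then 1 else 0) sizeMismatch)
                     (cong (λ b → if b then 1 else 0) (∧-zeroʳ (ρ ⊆ᵇ ρ₂)))
    where
    sizeMismatch : (suc ∣ ρ ∣ == (∣ σ ∣ + 0)) ≡ false
    sizeMismatch = trans (cong (suc ∣ ρ ∣ ==_) (+-identityʳ ∣ σ ∣))
                         (<⇒==≡false (s≤s (⊆ᵇ⇒∣∣≤∣∣ σ ρ σ⊆ρ)))
count-interval≡C {suc n} (false ∷ σ) (true ∷ ρ₂) (suc k) σ⊆ρ₂ = begin
  ∑ (λ ρ → if σ ⊆ᵇ ρ ∧ (ρ ⊆ᵇ ρ₂ ∧ (suc ∣ ρ ∣ == (∣ σ ∣ + suc k))) then 1 else 0) + _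
    ≡⟨ cong₂ _+_ (∑-cong (λ ρ → cong (λ m → if σ ⊆ᵇ ρ ∧ (ρ ⊆ᵇ ρ₂ ∧ (suc ∣ ρ ∣ == m)) then 1 else 0)
                                     (+-suc ∣ σ ∣ k)))
                 (count-interval≡C σ ρ₂ (suc k) σ⊆ρ₂) ⟩
  ∑ (λ ρ → if σ ⊆ᵇ ρ ∧ (ρ ⊆ᵇ ρ₂ ∧ (∣ ρ ∣ == (∣ σ ∣ + k))) then 1 else 0) + m C suc k
    ≡⟨ cong (_+ m C suc k) (count-interval≡C σ ρ₂ k σ⊆ρ₂) ⟩
  m C k + m C suc k
    ≡⟨ nCk+nC[k+1]≡[n+1]C[k+1] m k ⟩
  suc m C suc k
    ≡⟨ cong (_C suc k) (+-∸-assoc 1 (⊆ᵇ⇒∣∣≤∣∣ σ ρ₂ σ⊆ρ₂)) ⟨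
  (suc ∣ ρ₂ ∣ ∸ ∣ σ ∣) C suc k ∎
  where
  open ≡-Reasoning
  m = ∣ ρ₂ ∣ ∸ ∣ σ ∣

count-subsets≡C : ∀ {n} (ρ : Subset n) s → ∑ (λ σ → if σ ⊆ᵇ ρ ∧ (∣ σ ∣ == s) then 1 else 0) ≡ ∣ ρ ∣ C s
count-subsets≡C {n} ρ s = begin
  ∑ (λ σ → if σ ⊆ᵇ ρ ∧ (∣ σ ∣ == s) then 1 else 0)
    ≡⟨ ∑-cong (λ σ → cong₂ (λ b m → if b ∧ (σ ⊆ᵇ ρ ∧ (∣ σ ∣ == m)) then 1 else 0)
                           (⊆⇒⊆ᵇ ⊥ σ ⊥⊆) (cong (_+ s) (∣⊥∣≡0 n))) ⟨
  ∑ (λ σ → if ⊥ ⊆ᵇ σ ∧ (σ ⊆ᵇ ρ ∧ (∣ σ ∣ == (∣ ⊥ {n = n} ∣ + s))) then 1 else 0)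
    ≡⟨ count-interval≡C ⊥ ρ s (⊆⇒⊆ᵇ ⊥ ρ ⊥⊆) ⟩
  (∣ ρ ∣ ∸ ∣ ⊥ {n = n} ∣) C s
    ≡⟨ cong (λ m → (∣ ρ ∣ ∸ m) C s) (∣⊥∣≡0 n) ⟩
  ∣ ρ ∣ C s ∎
  where open ≡-Reasoning

[1+s]Cs≡1+s : ∀ s → suc s C s ≡ suc s
[1+s]Cs≡1+s s = trans (nCk≡nC[n∸k] (n≤1+n s)) (trans (cong (suc s C_) (m+n∸n≡m 1 s)) (nC1≡n (suc s)))

mkℚ≤ratio⇒ : ∀ {p q} .{cop : Coprime p (suc q)} a b → mkℚ (ℤ.+ p) q cop ℚ.≤ ratio a b → p * b ≤ a * suc q
mkℚ≤ratio⇒ {p}     a zero    _     rewrite *-zeroʳ p = z≤n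
mkℚ≤ratio⇒ {p} {q} a (suc b) c≤a/b =
  ℤₚ.drop‿+≤+ (subst₂ ℤ._≤_ (sym (ℤₚ.pos-* p (suc b))) (sym (ℤₚ.pos-* a (suc q))) (ℚᵘₚ.drop-*≤* unnormalised))
  where
  unnormalised : ℚᵘ.mkℚᵘ (ℤ.+ p) q ℚᵘ.≤ ℚᵘ.mkℚᵘ (ℤ.+ a) b
  unnormalised = ℚᵘₚ.≤-respʳ-≃ (ℚₚ.toℚᵘ-fromℚᵘ (ℚᵘ.mkℚᵘ (ℤ.+ a) b)) (ℚₚ.toℚᵘ-mono-≤ c≤a/b)

mkℚ*ratio≤ratio : ∀ {p q} .{cop : Coprime p (suc q)} A P B Q →
  p * A * suc Q ≤ B * (suc q * suc P) → mkℚ (ℤ.+ p) q cop ℚ.* ratio A (suc P) ℚ.≤ ratio B (suc Q)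
mkℚ*ratio≤ratio {p} {q} {cop} A P B Q cross =
  ℚₚ.toℚᵘ-cancel-≤ (ℚᵘₚ.≤-respˡ-≃ (ℚᵘₚ.≃-sym toℚᵘ-product)
                   (ℚᵘₚ.≤-respʳ-≃ (ℚᵘₚ.≃-sym (ℚₚ.toℚᵘ-fromℚᵘ (ℚᵘ.mkℚᵘ (ℤ.+ B) Q))) unnormalised))
  where
  c = mkℚ (ℤ.+ p) q cop
  toℚᵘ-product : toℚᵘ (c ℚ.* ratio A (suc P)) ℚᵘ.≃ ℚᵘ.mkℚᵘ (ℤ.+ p) q ℚᵘ.* ℚᵘ.mkℚᵘ (ℤ.+ A) P
  toℚᵘ-product = ℚᵘₚ.≃-trans (ℚₚ.toℚᵘ-homo-* c (ratio A (suc P)))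
                              (ℚᵘₚ.*-congˡ {ℚᵘ.mkℚᵘ (ℤ.+ p) q} (ℚₚ.toℚᵘ-fromℚᵘ (ℚᵘ.mkℚᵘ (ℤ.+ A) P)))
  unnormalised : ℚᵘ.mkℚᵘ (ℤ.+ p) q ℚᵘ.* ℚᵘ.mkℚᵘ (ℤ.+ A) P ℚᵘ.≤ ℚᵘ.mkℚᵘ (ℤ.+ B) Q
  unnormalised = ℚᵘ.*≤* (subst₂ ℤ._≤_ (trans (ℤₚ.pos-* (p * A) (suc Q)) (cong (ℤ._* ℤ.+ suc Q) (ℤₚ.pos-* p A)))
                                       (ℤₚ.pos-* B (suc q * suc P)) (+≤+ cross))

-- (p / (1 + q)) · (a / P) ≤ B / Q, cross-multiplied and rescaled by (1 + m′) · Q = k · P.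
mkℚ*ratio≤ratio-rescaled : ∀ {p q} .{cop : Coprime p (suc q)} {m′ k a P B Q} → 0 < k →
  suc m′ * Q ≡ k * P → p * (k * a) ≤ (suc m′ * B) * suc q →
  mkℚ (ℤ.+ p) q cop ℚ.* ratio a P ℚ.≤ ratio B Q
mkℚ*ratio≤ratio-rescaled {p} {q} {cop} {P = zero} {B} {Q} _ _ _ = begin
  mkℚ (ℤ.+ p) q cop ℚ.* 0ℚ   ≡⟨ ℚₚ.*-zeroʳ (mkℚ (ℤ.+ p) q cop) ⟩
  0ℚ                       ≤⟨ ℚₚ.nonNegative⁻¹ (ratio B Q) {{ratio-nonNeg Q}} ⟩
  ratio B Q                ∎
  where
  open ℚₚ.≤-Reasoning
  ratio-nonNeg : ∀ Q → ℚ.NonNegative (ratio B Q)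
  ratio-nonNeg zero    = _
  ratio-nonNeg (suc Q) = ℚₚ.normalize-nonNeg B (suc Q)
mkℚ*ratio≤ratio-rescaled {k = zero} {P = suc P} {Q = zero} () _ _
mkℚ*ratio≤ratio-rescaled {m′ = m′} {suc k} {P = suc P} {Q = zero} _ mQ≡kP _
  with () ← trans (sym (*-zeroʳ (suc m′))) mQ≡kP
mkℚ*ratio≤ratio-rescaled {p} {q} {m′ = m′} {k} {a} {suc P} {B} {suc Q} _ mQ≡kP ineq =
  mkℚ*ratio≤ratio a P B Q (*-cancelˡ-≤ (suc m′) (begin
    suc m′ * (p * a * suc Q)         ≡⟨ solve 4 (λ m p a Q → m :* (p :* a :* Q) := p :* a :* (m :* Q)) refl (suc m′) p a (suc Q) ⟩
    p * a * (suc m′ * suc Q)         ≡⟨ cong (p * a *_) mQ≡kP ⟩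
    p * a * (k * suc P)              ≡⟨ solve 4 (λ p a k P → p :* a :* (k :* P) := p :* (k :* a) :* P) refl p a k (suc P) ⟩
    p * (k * a) * suc P              ≤⟨ *-monoˡ-≤ (suc P) ineq ⟩
    suc m′ * B * suc q * suc P       ≡⟨ solve 4 (λ m B q P → m :* B :* q :* P := m :* (B :* (q :* P))) refl (suc m′) B (suc q) (suc P) ⟩
    suc m′ * (B * (suc q * suc P))   ∎))
  where
  open ≤-Reasoning
  open +-*-Solver

^ℚ-nonNeg : ∀ {η} → 0ℚ ℚ.≤ η → ∀ k → 0ℚ ℚ.≤ η ^ℚ k
^ℚ-nonNeg         0≤η zero    = ℚₚ.nonNegative⁻¹ ℚ.1ℚ
^ℚ-nonNeg {η = η} 0≤η (suc k) = ℚₚ.nonNegative⁻¹ (η ℚ.* η ^ℚ k)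
  {{ℚₚ.nonNeg*nonNeg⇒nonNeg η {{ℚ.nonNegative 0≤η}} (η ^ℚ k) {{ℚ.nonNegative (^ℚ-nonNeg 0≤η k)}}}}

^ℚ-+ : ∀ η a b → η ^ℚ (a + b) ≡ η ^ℚ a ℚ.* η ^ℚ b
^ℚ-+ η zero    b = sym (ℚₚ.*-identityˡ (η ^ℚ b))
^ℚ-+ η (suc a) b = trans (cong (η ℚ.*_) (^ℚ-+ η a b)) (sym (ℚₚ.*-assoc η (η ^ℚ a) (η ^ℚ b)))

2^[1+g]∸1 : ∀ g → 2 ^ suc g ∸ 1 ≡ (2 ^ g ∸ 1) + 2 ^ g
2^[1+g]∸1 g = trans (+-∸-comm (2 ^ g + 0) (m^n>0 2 g)) (cong ((2 ^ g ∸ 1) +_) (+-identityʳ (2 ^ g)))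

isFace : ∀ {n} → Family n → ℕ → Subset n → Bool
isFace X s σ = X σ ∧ (∣ σ ∣ == s)

weight : ∀ {n} → Family n → ℕ → ℕ → Family n → ℕ
weight X D s U = ∑ (λ σ → if isFace X s σ then (if U σ then deg X D σ else 0) else 0)

totalWeight : ∀ {n} → Family n → ℕ → ℕ → ℕ
totalWeight X D s = ∑ (λ σ → if isFace X s σ then deg X D σ else 0)

cofaceSum : ∀ {n} → Family n → ℕ → (Subset n → ℕ) → Subset n → ℕ
cofaceSum X s h σ = ∑ (λ ρ → if σ ⊆ᵇ ρ then (if isFace X (suc s) ρ then h ρ else 0) else 0)

deg≡∑ : ∀ {n} (X : Family n) D σ →
        deg X D σ ≡ ∑ (λ ρ → if isFace X D ρ then (if σ ⊆ᵇ ρ then 1 else 0) else 0)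
deg≡∑ {n} X D σ = begin
  length (filter (T? ∘ (σ ⊆ᵇ_)) (facesOfSize X D))
    ≡⟨ length≡sum-map-1 (filter (T? ∘ (σ ⊆ᵇ_)) (facesOfSize X D)) ⟩
  sum (map (λ _ → 1) (filter (T? ∘ (σ ⊆ᵇ_)) (facesOfSize X D)))
    ≡⟨ sum-map-filter (σ ⊆ᵇ_) (λ _ → 1) (facesOfSize X D) ⟩
  sum (map (λ ρ → if σ ⊆ᵇ ρ then 1 else 0) (facesOfSize X D))
    ≡⟨ sum-map-filter (isFace X D) _ (allSubsets n) ⟩
  sum (map (λ ρ → if isFace X D ρ then (if σ ⊆ᵇ ρ then 1 else 0) else 0) (allSubsets n))
    ≡⟨ sum-map-allSubsets {n} _ ⟩
  ∑ (λ ρ → if isFace X D ρ then (if σ ⊆ᵇ ρ then 1 else 0) else 0) ∎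
  where open ≡-Reasoning

norm≡ratio : ∀ {n} (X : Family n) D s U → norm X D s U ≡ ratio (weight X D s U) (totalWeight X D s)
norm≡ratio {n} X D s U = cong₂ ratio
  (trans (sum-map-filter (isFace X s) _ (allSubsets n)) (sum-map-allSubsets {n} _))
  (trans (sum-map-filter (isFace X s) _ (allSubsets n)) (sum-map-allSubsets {n} _))

module _ {n} (X : Family n) (D : ℕ) where

  deg-link : ∀ σ → ∣ σ ∣ ≤ D → ∀ τ → disjᵇ τ σ ≡ true →
             deg (link X σ) (D ∸ ∣ σ ∣) τ ≡ deg X D (τ ∪ σ)
  deg-link σ σ≤D τ τ∩σ=∅ = begin
    deg (link X σ) (D ∸ ∣ σ ∣) τ
      ≡⟨ deg≡∑ (link X σ) (D ∸ ∣ σ ∣) τ ⟩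
    ∑ (λ ρ → if isFace (link X σ) (D ∸ ∣ σ ∣) ρ then (if τ ⊆ᵇ ρ then 1 else 0) else 0)
      ≡⟨ ∑-cong translate ⟩
    ∑ (λ ρ → if disjᵇ ρ σ then g (ρ ∪ σ) else 0)
      ≡⟨ ∑-disjoint-∪ σ g ⟩
    ∑ (λ ρ → if σ ⊆ᵇ ρ then g ρ else 0)
      ≡⟨ ∑-cong vanishesOffCone ⟩
    ∑ g
      ≡⟨ deg≡∑ X D (τ ∪ σ) ⟨
    deg X D (τ ∪ σ) ∎
    where
    open ≡-Reasoning
    g : Subset n → ℕ
    g ρ = if isFace X D ρ then (if (τ ∪ σ) ⊆ᵇ ρ then 1 else 0) else 0
    translate : ∀ ρ → (if isFace (link X σ) (D ∸ ∣ σ ∣) ρ then (if τ ⊆ᵇ ρ then 1 else 0) else 0)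
                      ≡ (if disjᵇ ρ σ then g (ρ ∪ σ) else 0)
    translate ρ with disjᵇ ρ σ in ρ∩σ=∅
    ... | false = refl
    ... | true  = cong₂ (λ b c → if X (ρ ∪ σ) ∧ b then (if c then 1 else 0) else 0)
                        (trans (==-∸ ∣ ρ ∣ σ≤D) (cong (_== D) (sym (∣p∪q∣≡∣p∣+∣q∣ ρ σ ρ∩σ=∅))))
                        (sym (p∪r⊆ᵇq∪r≡p⊆ᵇq τ ρ σ τ∩σ=∅ ρ∩σ=∅))
    vanishesOffCone : ∀ ρ → (if σ ⊆ᵇ ρ then g ρ else 0) ≡ g ρ
    vanishesOffCone ρ with σ ⊆ᵇ ρ in σ⊆ρ | (τ ∪ σ) ⊆ᵇ ρ in τσ⊆ρ
    ... | true  | _     = refl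
    ... | false | false = sym (if-eta (isFace X D ρ))
    ... | false | true
      with () ← trans (sym σ⊆ρ) (⊆⇒⊆ᵇ σ ρ (⊆-trans (q⊆p∪q τ σ) (⊆ᵇ⇒⊆ (τ ∪ σ) ρ τσ⊆ρ)))

  ∑-linkVertices : ∀ σ {s} → ∣ σ ∣ ≡ s → (h : Subset n → ℕ) →
    ∑ (λ τ → if isFace (link X σ) 1 τ then h (τ ∪ σ) else 0) ≡ cofaceSum X s h σ
  ∑-linkVertices σ {s} ∣σ∣≡s h = trans (∑-cong translate) (∑-disjoint-∪ σ _)
    where
    translate : ∀ τ → (if isFace (link X σ) 1 τ then h (τ ∪ σ) else 0)
                      ≡ (if disjᵇ τ σ then (if isFace X (suc s) (τ ∪ σ) then h (τ ∪ σ) else 0) else 0)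
    translate τ with disjᵇ τ σ in τ∩σ=∅
    ... | false = refl
    ... | true  = cong (λ b → if X (τ ∪ σ) ∧ b then h (τ ∪ σ) else 0) (begin
      (∣ τ ∣ == 1)                   ≡⟨ ==-+ʳ s {∣ τ ∣} {1} ⟨
      ((∣ τ ∣ + s) == suc s)          ≡⟨ cong (λ m → (∣ τ ∣ + m) == suc s) ∣σ∣≡s ⟨
      ((∣ τ ∣ + ∣ σ ∣) == suc s)      ≡⟨ cong (_== suc s) (∣p∪q∣≡∣p∣+∣q∣ τ σ τ∩σ=∅) ⟨
      (∣ τ ∪ σ ∣ == suc s)            ∎)
      where open ≡-Reasoning

  weight-link : ∀ σ {s} → ∣ σ ∣ ≡ s → s ≤ D → ∀ U →
    weight (link X σ) (D ∸ ∣ σ ∣) 1 (restr X U σ) ≡ cofaceSum X s (λ ρ → if U ρ then deg X D ρ else 0) σ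
  weight-link σ ∣σ∣≡s s≤D U =
    trans (∑-cong-if (isFace (link X σ) 1) inLink) (∑-linkVertices σ ∣σ∣≡s _)
    where
    inLink : ∀ τ → isFace (link X σ) 1 τ ≡ true →
             (if restr X U σ τ then deg (link X σ) (D ∸ ∣ σ ∣) τ else 0)
             ≡ (if U (τ ∪ σ) then deg X D (τ ∪ σ) else 0)
    inLink τ τ-vertex with τ∈link , _ ← ∧≡true⁻ τ-vertex with τ∩σ=∅ , _ ← ∧≡true⁻ τ∈link =
      cong₂ (λ b m → if b then m else 0) (cong (_∧ U (τ ∪ σ)) τ∈link)
            (deg-link σ (subst (_≤ D) (sym ∣σ∣≡s) s≤D) τ τ∩σ=∅)

  totalWeight-link : ∀ σ {s} → ∣ σ ∣ ≡ s → s ≤ D →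
    totalWeight (link X σ) (D ∸ ∣ σ ∣) 1 ≡ cofaceSum X s (deg X D) σ
  totalWeight-link σ ∣σ∣≡s s≤D =
    trans (∑-cong-if (isFace (link X σ) 1) inLink) (∑-linkVertices σ ∣σ∣≡s _)
    where
    inLink : ∀ τ → isFace (link X σ) 1 τ ≡ true → deg (link X σ) (D ∸ ∣ σ ∣) τ ≡ deg X D (τ ∪ σ)
    inLink τ τ-vertex with τ∈link , _ ← ∧≡true⁻ τ-vertex with τ∩σ=∅ , _ ← ∧≡true⁻ τ∈link =
      deg-link σ (subst (_≤ D) (sym ∣σ∣≡s) s≤D) τ τ∩σ=∅

  -- Double counting: a face of size s + 1 has exactly s + 1 subsets of size s.
  ∑-cofaceSum : ∀ s (h : Subset n → ℕ) →
    ∑ (λ σ → if ∣ σ ∣ == s then cofaceSum X s h σ else 0)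
    ≡ suc s * ∑ (λ ρ → if isFace X (suc s) ρ then h ρ else 0)
  ∑-cofaceSum s h = begin
    ∑ (λ σ → if ∣ σ ∣ == s then ∑ (K σ) else 0)
      ≡⟨ ∑-cong (λ σ → ∑-if (∣ σ ∣ == s) (K σ)) ⟩
    ∑ (λ σ → ∑ (λ ρ → if ∣ σ ∣ == s then K σ ρ else 0))
      ≡⟨ ∑-swap (λ σ ρ → if ∣ σ ∣ == s then K σ ρ else 0) ⟩
    ∑ (λ ρ → ∑ (λ σ → if ∣ σ ∣ == s then K σ ρ else 0))
      ≡⟨ ∑-cong facetsOf ⟩
    ∑ (λ ρ → suc s * c ρ)
      ≡⟨ ∑-*ˡ (suc s) c ⟩
    suc s * ∑ c ∎
    where
    open ≡-Reasoning
    c : Subset n → ℕ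
    c ρ = if isFace X (suc s) ρ then h ρ else 0
    K : Subset n → Subset n → ℕ
    K σ ρ = if σ ⊆ᵇ ρ then c ρ else 0
    asProduct : ∀ ρ σ → (if ∣ σ ∣ == s then K σ ρ else 0) ≡ c ρ * (if σ ⊆ᵇ ρ ∧ (∣ σ ∣ == s) then 1 else 0)
    asProduct ρ σ with ∣ σ ∣ == s | σ ⊆ᵇ ρ
    ... | true  | true  = sym (*-identityʳ (c ρ))
    ... | true  | false = sym (*-zeroʳ (c ρ))
    ... | false | true  = sym (*-zeroʳ (c ρ))
    ... | false | false = sym (*-zeroʳ (c ρ))
    count : ∀ ρ → c ρ * (∣ ρ ∣ C s) ≡ suc s * c ρ
    count ρ with isFace X (suc s) ρ in ρ∈X
    ... | false = sym (*-zeroʳ (suc s))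
    ... | true  = begin
      h ρ * (∣ ρ ∣ C s) ≡⟨ cong (λ m → h ρ * (m C s)) (==⇒≡ (proj₂ (∧≡true⁻ ρ∈X))) ⟩
      h ρ * (suc s C s) ≡⟨ cong (h ρ *_) ([1+s]Cs≡1+s s) ⟩
      h ρ * suc s       ≡⟨ *-comm (h ρ) (suc s) ⟩
      suc s * h ρ       ∎
    facetsOf : ∀ ρ → ∑ (λ σ → if ∣ σ ∣ == s then K σ ρ else 0) ≡ suc s * c ρ
    facetsOf ρ = trans (∑-cong (asProduct ρ))
                 (trans (∑-*ˡ {n} (c ρ) _) (trans (cong (c ρ *_) (count-subsets≡C ρ s)) (count ρ)))

module _ {n} {X : Family n} (isc : IsSimplicialComplex X) (D : ℕ) where
  open IsSimplicialComplex isc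

  ⊆ᵇ-face : ∀ σ ρ → (σ ⊆ᵇ ρ) ≡ true → X ρ ≡ true → X σ ≡ true
  ⊆ᵇ-face σ ρ σ⊆ρ = downClosed ρ σ (⊆ᵇ⇒⊆ σ ρ σ⊆ρ)

  deg≡0 : ∀ σ → X σ ≡ false → deg X D σ ≡ 0
  deg≡0 σ σ∉X = trans (deg≡∑ X D σ) (∑-zero noTopFace)
    where
    noTopFace : ∀ ρ → (if isFace X D ρ then (if σ ⊆ᵇ ρ then 1 else 0) else 0) ≡ 0
    noTopFace ρ with isFace X D ρ in ρ-top | σ ⊆ᵇ ρ in σ⊆ρ
    ... | false | _     = refl
    ... | true  | false = refl
    ... | true  | true
      with () ← trans (sym σ∉X) (⊆ᵇ-face σ ρ σ⊆ρ (proj₁ (∧≡true⁻ ρ-top)))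

  count-cofaces-in-top : ∀ σ {s} → ∣ σ ∣ ≡ s → ∀ ρ₂ → isFace X D ρ₂ ≡ true →
    ∑ (λ ρ → if σ ⊆ᵇ ρ then (if isFace X (suc s) ρ then (if ρ ⊆ᵇ ρ₂ then 1 else 0) else 0) else 0)
    ≡ (D ∸ s) * (if σ ⊆ᵇ ρ₂ then 1 else 0)
  count-cofaces-in-top σ {s} ∣σ∣≡s ρ₂ ρ₂-top = trans (∑-cong asInterval) count
    where
    I : Subset n → ℕ
    I ρ = if σ ⊆ᵇ ρ ∧ (ρ ⊆ᵇ ρ₂ ∧ (∣ ρ ∣ == (∣ σ ∣ + 1))) then 1 else 0
    asInterval : ∀ ρ → (if σ ⊆ᵇ ρ then (if isFace X (suc s) ρ then (if ρ ⊆ᵇ ρ₂ then 1 else 0) else 0) else 0) ≡ I ρ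
    asInterval ρ with σ ⊆ᵇ ρ
    ... | false = refl
    ... | true with ρ ⊆ᵇ ρ₂ in ρ⊆ρ₂
    ...   | false = if-eta (isFace X (suc s) ρ)
    ...   | true rewrite ⊆ᵇ-face ρ ρ₂ ρ⊆ρ₂ (proj₁ (∧≡true⁻ ρ₂-top)) =
      cong (λ m → if ∣ ρ ∣ == m then 1 else 0) (trans (cong suc (sym ∣σ∣≡s)) (+-comm 1 ∣ σ ∣))
    count : ∑ I ≡ (D ∸ s) * (if σ ⊆ᵇ ρ₂ then 1 else 0)
    count with σ ⊆ᵇ ρ₂ in σ⊆ρ₂
    ... | true = begin
      ∑ I                     ≡⟨ count-interval≡C σ ρ₂ 1 σ⊆ρ₂ ⟩
      (∣ ρ₂ ∣ ∸ ∣ σ ∣) C 1     ≡⟨ nC1≡n (∣ ρ₂ ∣ ∸ ∣ σ ∣) ⟩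
      ∣ ρ₂ ∣ ∸ ∣ σ ∣           ≡⟨ cong₂ _∸_ (==⇒≡ (proj₂ (∧≡true⁻ ρ₂-top))) ∣σ∣≡s ⟩
      D ∸ s                   ≡⟨ *-identityʳ (D ∸ s) ⟨
      (D ∸ s) * 1             ∎
      where open ≡-Reasoning
    ... | false = trans (∑-zero outside) (sym (*-zeroʳ (D ∸ s)))
      where
      outside : ∀ ρ → I ρ ≡ 0
      outside ρ with σ ⊆ᵇ ρ in σ⊆ρ | ρ ⊆ᵇ ρ₂ in ρ⊆ρ₂
      ... | false | _     = refl
      ... | true  | false = refl
      ... | true  | true  with () ← trans (sym σ⊆ρ₂) (⊆ᵇ-trans σ ρ ρ₂ σ⊆ρ ρ⊆ρ₂)

  -- Double counting: a top face containing σ contains D ∸ |σ| faces of size |σ| + 1 containing σ.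
  cofaceSum-deg : ∀ σ {s} → ∣ σ ∣ ≡ s → cofaceSum X s (deg X D) σ ≡ (D ∸ s) * deg X D σ
  cofaceSum-deg σ {s} ∣σ∣≡s = begin
    cofaceSum X s (deg X D) σ                        ≡⟨ ∑-cong expand ⟩
    ∑ (λ ρ → ∑ (F ρ))                                ≡⟨ ∑-swap F ⟩
    ∑ (λ ρ₂ → ∑ (λ ρ → F ρ ρ₂))                      ≡⟨ ∑-cong perTopFace ⟩
    ∑ (λ ρ₂ → (D ∸ s) * containsσ ρ₂)                ≡⟨ ∑-*ˡ (D ∸ s) containsσ ⟩
    (D ∸ s) * ∑ containsσ                            ≡⟨ cong ((D ∸ s) *_) (deg≡∑ X D σ) ⟨
    (D ∸ s) * deg X D σ                              ∎
    where
    open ≡-Reasoning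
    containsσ : Subset n → ℕ
    containsσ ρ₂ = if isFace X D ρ₂ then (if σ ⊆ᵇ ρ₂ then 1 else 0) else 0
    F : Subset n → Subset n → ℕ
    F ρ ρ₂ = if σ ⊆ᵇ ρ then (if isFace X (suc s) ρ then
               (if isFace X D ρ₂ then (if ρ ⊆ᵇ ρ₂ then 1 else 0) else 0) else 0) else 0
    expand : ∀ ρ → (if σ ⊆ᵇ ρ then (if isFace X (suc s) ρ then deg X D ρ else 0) else 0) ≡ ∑ (F ρ)
    expand ρ = begin
      (if σ ⊆ᵇ ρ then (if isFace X (suc s) ρ then deg X D ρ else 0) else 0)
        ≡⟨ cong (λ m → if σ ⊆ᵇ ρ then (if isFace X (suc s) ρ then m else 0) else 0) (deg≡∑ X D ρ) ⟩
      (if σ ⊆ᵇ ρ then (if isFace X (suc s) ρ then ∑ {n} _ else 0) else 0)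
        ≡⟨ cong (λ m → if σ ⊆ᵇ ρ then m else 0) (∑-if {n} (isFace X (suc s) ρ) _) ⟩
      (if σ ⊆ᵇ ρ then ∑ {n} _ else 0)
        ≡⟨ ∑-if {n} (σ ⊆ᵇ ρ) _ ⟩
      ∑ (F ρ) ∎
    perTopFace : ∀ ρ₂ → ∑ (λ ρ → F ρ ρ₂) ≡ (D ∸ s) * containsσ ρ₂
    perTopFace ρ₂ with isFace X D ρ₂ in ρ₂-top
    ... | true  = count-cofaces-in-top σ ∣σ∣≡s ρ₂ ρ₂-top
    ... | false = trans (∑-zero (λ ρ → trans (cong (λ m → if σ ⊆ᵇ ρ then m else 0)
                                                    (if-eta (isFace X (suc s) ρ)))
                                             (if-eta (σ ⊆ᵇ ρ))))
                        (sym (*-zeroʳ (D ∸ s)))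

  totalWeight-succ : ∀ s → suc s * totalWeight X D (suc s) ≡ (D ∸ s) * totalWeight X D s
  totalWeight-succ s = begin
    suc s * totalWeight X D (suc s)
      ≡⟨ ∑-cofaceSum X D s (deg X D) ⟨
    ∑ (λ σ → if ∣ σ ∣ == s then cofaceSum X s (deg X D) σ else 0)
      ≡⟨ ∑-cong ofSize ⟩
    ∑ (λ σ → (D ∸ s) * (if isFace X s σ then deg X D σ else 0))
      ≡⟨ ∑-*ˡ {n} (D ∸ s) _ ⟩
    (D ∸ s) * totalWeight X D s ∎
    where
    open ≡-Reasoning
    ofSize : ∀ σ → (if ∣ σ ∣ == s then cofaceSum X s (deg X D) σ else 0)
                   ≡ (D ∸ s) * (if isFace X s σ then deg X D σ else 0)
    ofSize σ with ∣ σ ∣ == s in ∣σ∣≡s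
    ... | false rewrite ∧-zeroʳ (X σ) = sym (*-zeroʳ (D ∸ s))
    ... | true with X σ in σ∈X
    ...   | true  = cofaceSum-deg σ (==⇒≡ ∣σ∣≡s)
    ...   | false = trans (cofaceSum-deg σ (==⇒≡ ∣σ∣≡s)) (cong ((D ∸ s) *_) (deg≡0 σ σ∈X))

  linkNorm≡ratio : ∀ U σ {s} → ∣ σ ∣ ≡ s → s ≤ D →
    linkNorm X D (suc s) U σ
    ≡ ratio (cofaceSum X s (λ ρ → if U ρ then deg X D ρ else 0) σ) ((D ∸ s) * deg X D σ)
  linkNorm≡ratio U σ refl s≤D = begin
    norm (link X σ) (D ∸ ∣ σ ∣) (suc ∣ σ ∣ ∸ ∣ σ ∣) (restr X U σ)
      ≡⟨ cong (λ l → norm (link X σ) (D ∸ ∣ σ ∣) l (restr X U σ)) (m+n∸n≡m 1 ∣ σ ∣) ⟩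
    norm (link X σ) (D ∸ ∣ σ ∣) 1 (restr X U σ)
      ≡⟨ norm≡ratio (link X σ) (D ∸ ∣ σ ∣) 1 (restr X U σ) ⟩
    ratio (weight (link X σ) (D ∸ ∣ σ ∣) 1 (restr X U σ)) (totalWeight (link X σ) (D ∸ ∣ σ ∣) 1)
      ≡⟨ cong₂ ratio (weight-link X D σ refl s≤D U)
                     (trans (totalWeight-link X D σ refl s≤D) (cofaceSum-deg σ refl)) ⟩
    ratio (cofaceSum X ∣ σ ∣ (λ ρ → if U ρ then deg X D ρ else 0) σ) ((D ∸ ∣ σ ∣) * deg X D σ) ∎
    where open ≡-Reasoning

  norm-≤-via-links : ∀ {s} → s < D → (U V : Family n) (c : ℚ) → 0ℚ ℚ.≤ c →
    (∀ σ → V σ ≡ true → ∣ σ ∣ ≡ s × c ℚ.≤ linkNorm X D (suc s) U σ) →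
    c ℚ.* norm X D s V ℚ.≤ norm X D (suc s) U
  norm-≤-via-links s<D U V (mkℚ -[1+ _ ] _ _) (ℚ.*≤* ()) _
  norm-≤-via-links {s} s<D U V c@(mkℚ (ℤ.+ p) q _) _ dense =
    subst₂ (λ x y → c ℚ.* x ℚ.≤ y) (sym (norm≡ratio X D s V)) (sym (norm≡ratio X D (suc s) U))
      (mkℚ*ratio≤ratio-rescaled {m′ = s} {B = weight X D (suc s) U} {Q = totalWeight X D (suc s)}
                                 (m<n⇒0<n∸m s<D) (totalWeight-succ s) summed)
    where
    Uweight : Subset n → ℕ
    Uweight ρ = if U ρ then deg X D ρ else 0
    Vweight : Subset n → ℕ
    Vweight σ = if isFace X s σ then (if V σ then deg X D σ else 0) else 0
    cofaces : Subset n → ℕ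
    cofaces σ = if ∣ σ ∣ == s then cofaceSum X s Uweight σ else 0
    perFace : ∀ σ → p * ((D ∸ s) * Vweight σ) ≤ cofaces σ * suc q
    perFace σ with ∣ σ ∣ == s in ∣σ∣≡s | X σ | V σ in σ∈V
    ... | false | x     | _     rewrite ∧-zeroʳ x | *-zeroʳ (D ∸ s) | *-zeroʳ p = z≤n
    ... | true  | false | _     rewrite *-zeroʳ (D ∸ s) | *-zeroʳ p = z≤n
    ... | true  | true  | false rewrite *-zeroʳ (D ∸ s) | *-zeroʳ p = z≤n
    ... | true  | true  | true  = mkℚ≤ratio⇒ _ _
          (subst (c ℚ.≤_) (linkNorm≡ratio U σ (==⇒≡ ∣σ∣≡s) (<⇒≤ s<D)) (proj₂ (dense σ σ∈V)))
    summed : p * ((D ∸ s) * weight X D s V) ≤ (suc s * weight X D (suc s) U) * suc q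
    summed = begin
      p * ((D ∸ s) * ∑ Vweight)
        ≡⟨ trans (∑-*ˡ {n} p (λ σ → (D ∸ s) * Vweight σ)) (cong (p *_) (∑-*ˡ (D ∸ s) Vweight)) ⟨
      ∑ (λ σ → p * ((D ∸ s) * Vweight σ)) ≤⟨ ∑-mono perFace ⟩
      ∑ (λ σ → cofaces σ * suc q)        ≡⟨ ∑-*ʳ (suc q) cofaces ⟩
      ∑ cofaces * suc q                  ≡⟨ cong (_* suc q) (∑-cofaceSum X D s Uweight) ⟩
      suc s * weight X D (suc s) U * suc q ∎
      where open ≤-Reasoning

fat-suc⇒ : ∀ {n} {X : Family n} {d η i W g} σ → g ≤ i → fat X d η i W (suc g) σ ≡ true →
  ∣ σ ∣ ≡ i ∸ g × η ^ℚ (2 ^ g) ℚ.≤ linkNorm X (suc d) (suc (i ∸ g)) (fat X d η i W g) σ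
fat-suc⇒ {X = X} {d} {η} {i} {W} {g} σ g≤i σ∈S
  with _ , σ∈S′ ← ∧≡true⁻ {X σ} σ∈S
  with ofSize , dense ← ∧≡true⁻ {∣ σ ∣ == (i ∸ g)} σ∈S′ =
  ==⇒≡ ofSize ,
  subst (λ l → η ^ℚ (2 ^ g) ℚ.≤ linkNorm X (suc d) l (fat X d η i W g) σ)
        (+-∸-assoc 1 g≤i) (ℚₚ.≤ᵇ⇒≤ (subst T (sym dense) tt))

norm-fat : ∀ {n d} {X : Family n} → IsSimplicialComplex X → ∀ {i} → i < d → ∀ {η} → 0ℚ ℚ.≤ η →
  ∀ W g → g ≤ suc i →
  η ^ℚ (2 ^ g ∸ 1) ℚ.* norm X (suc d) (suc i ∸ g) (fat X d η i W g) ℚ.≤ norm X (suc d) (suc i) W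
norm-fat isc i<d 0≤η W zero _ = ℚₚ.≤-reflexive (ℚₚ.*-identityˡ _)
norm-fat {d = d} {X} isc {i} i<d {η} 0≤η W (suc g) (s≤s g≤i) = begin
  η ^ℚ (2 ^ suc g ∸ 1) ℚ.* ‖S[g+1]‖
    ≡⟨ cong (λ e → η ^ℚ e ℚ.* ‖S[g+1]‖) (2^[1+g]∸1 g) ⟩
  η ^ℚ ((2 ^ g ∸ 1) + 2 ^ g) ℚ.* ‖S[g+1]‖
    ≡⟨ trans (cong (ℚ._* ‖S[g+1]‖) (^ℚ-+ η (2 ^ g ∸ 1) (2 ^ g)))
             (ℚₚ.*-assoc (η ^ℚ (2 ^ g ∸ 1)) (η ^ℚ (2 ^ g)) ‖S[g+1]‖) ⟩
  η ^ℚ (2 ^ g ∸ 1) ℚ.* (η ^ℚ (2 ^ g) ℚ.* ‖S[g+1]‖)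
    ≤⟨ ℚₚ.*-monoˡ-≤-nonNeg (η ^ℚ (2 ^ g ∸ 1)) {{ℚ.nonNegative (^ℚ-nonNeg 0≤η (2 ^ g ∸ 1))}} oneLevel ⟩
  η ^ℚ (2 ^ g ∸ 1) ℚ.* norm X (suc d) (suc i ∸ g) (fat X d η i W g)
    ≤⟨ norm-fat isc i<d 0≤η W g (m≤n⇒m≤1+n g≤i) ⟩
  norm X (suc d) (suc i) W ∎
  where
  open ℚₚ.≤-Reasoning
  ‖S[g+1]‖ : ℚ
  ‖S[g+1]‖ = norm X (suc d) (i ∸ g) (fat X d η i W (suc g))
  oneLevel : η ^ℚ (2 ^ g) ℚ.* ‖S[g+1]‖ ℚ.≤ norm X (suc d) (suc i ∸ g) (fat X d η i W g)
  oneLevel = subst (λ l → η ^ℚ (2 ^ g) ℚ.* ‖S[g+1]‖ ℚ.≤ norm X (suc d) l (fat X d η i W g))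
                   (sym (+-∸-assoc 1 g≤i))
                   (norm-≤-via-links isc (suc d) (s≤s (≤-trans (m∸n≤m i g) (<⇒≤ i<d)))
                                     _ _ _ (^ℚ-nonNeg 0≤η (2 ^ g)) (λ σ → fat-suc⇒ σ g≤i))

lemma2p9 : (n d : ℕ) (X : Family n) → IsSimplicialComplex X → IsPure X d →
    (i : ℕ) → i < d → (η : ℚ) → 0ℚ ℚ.< η → η ℚ.< ℚ.1ℚ →
    (W : Family n) → (∀ σ → W σ ≡ true → X σ ≡ true × ∣ σ ∣ ≡ suc i) →
    (g : ℕ) → g ≤ suc i →
    (η ^ℚ ((2 ^ g) ∸ 1)) ℚ.* norm X (suc d) (suc i ∸ g) (fat X d η i W g)
    ℚ.≤ norm X (suc d) (suc i) W
lemma2p9 n d X isc _ i i<d η 0<η _ W _ g g≤1+i = norm-fat isc i<d (ℚₚ.<⇒≤ 0<η) W g g≤1+i
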